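{- Let $V$ be a finite nonempty set and $f$ a non-expansive Boolean network on $V$. (1) Every subnetwork of $f$ has at most one fixed point if and only if $f$ has no positive-circular subnetwork. (2) Every subnetwork of $f$ has at least one fixed point if and only if $f$ has no negative-circular subnetwork.
   Context: $\mathbb{B}=\{0,1\}$, $d$ the Hamming distance. A network on a finite set $W$ is $g:\mathbb{B}^W\to\mathbb{B}^W$; $f$ is non-expansive if $d(f(x),f(y))\le d(x,y)$ for all $x,y$. For nonempty $I\subseteq V$ and $z\in\mathbb{B}^{V\setminus I}$, the subnetwork of $f$ induced by $z$ is the network $h$ on $I$ with $h(x|_I)=f(x)|_I$ for all $x$ whose restriction to $V\setminus I$ is $z$; $f$ is a subnetwork of itself. With $x^{j\alpha}$ denoting $x$ with $j$-component set to $\alpha$, $g_{ij}(x)=g_i(x^{j1})-g_i(x^{j0})$; $G(g)$ is the signed digraph on $W$ with a positive arc $j\to i$ if $g_{ij}(x)=1$ for some $x$ and a negative arc $j\to i$ if $g_{ij}(x)=-1$ for some $x$. $g$ is positive-circular (resp. negative-circular) if $G(g)$ has at most one arc from any vertex to any vertex, its underlying unsigned digraph is a directed cycle through all of $W$ (a loop if $|W|=1$), and it has an even (resp. odd) number of negative arcs. -}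

module Defs where

open import Data.Bool using (Bool; true; false; if_then_else_)
open import Data.Nat using (ℕ; zero; suc; _+_; _≤_; _%_)
open import Data.Nat.DivMod using (m%n<n)
open import Data.Fin using (Fin; toℕ; fromℕ<; _≟_)
open import Data.List using (map; allFin)
open import Data.Nat.ListAction using (sum)
open import Data.Product using (Σ; ∃; _×_; _,_)
open import Data.Sum using (_⊎_)
open import Relation.Nullary using (¬_; does)
open import Relation.Binary.PropositionalEquality using (_≡_; _≢_)
open import Function.Definitions using (Injective)

-- V is represented by Fin n.  Configurations x ∈ 𝔹^V.
Conf : ℕ → Set
Conf n = Fin n → Bool

Network : ℕ → Set
Network n = Conf n → Conf n

bit≢ : Bool → Bool → ℕ
bit≢ true  true  = 0
bit≢ false false = 0
bit≢ _     _     = 1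

hamming : ∀ {n} → Conf n → Conf n → ℕ
hamming {n} x y = sum (map (λ i → bit≢ (x i) (y i)) (allFin n))

NonExpansive : ∀ {n} → Network n → Set
NonExpansive f = ∀ x y → hamming (f x) (f y) ≤ hamming x y

upd : ∀ {n} → Conf n → Fin n → Bool → Conf n
upd x j α i = if does (i ≟ j) then α else x i

Subset : ℕ → Set
Subset n = Fin n → Bool

NonEmpty : ∀ {n} → Subset n → Set
NonEmpty I = ∃ λ i → I i ≡ true

-- The subnetwork of f induced by z ∈ 𝔹^{V∖I} is given by the pair (I , z),
-- where z is encoded as a full configuration whose values on I are ignored.
-- x "extends" z when x agrees with z outside I.
Extends : ∀ {n} → Subset n → Conf n → Conf n → Set
Extends I z x = ∀ j → I j ≡ false → x j ≡ z j

-- x|_I is a fixed point of the subnetwork h induced by z (x extending z):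
-- h(x|_I) = f(x)|_I = x|_I.
SubFixed : ∀ {n} → Network n → Subset n → Conf n → Conf n → Set
SubFixed f I z x = Extends I z x × (∀ i → I i ≡ true → f x i ≡ x i)

AtMostOneFixed : ∀ {n} → Network n → Subset n → Conf n → Set
AtMostOneFixed f I z =
  ∀ x y → SubFixed f I z x → SubFixed f I z y → ∀ i → I i ≡ true → x i ≡ y i

AtLeastOneFixed : ∀ {n} → Network n → Subset n → Conf n → Set
AtLeastOneFixed f I z = ∃ λ x → SubFixed f I z x

-- Arcs of G(h) for h the subnetwork induced by (I , z), between vertices j, i ∈ I:
-- h_{ij}(x) = h_i(x^{j1}) - h_i(x^{j0}) = 1  (positive arc), or = -1 (negative arc).
PosArc : ∀ {n} → Network n → Subset n → Conf n → Fin n → Fin n → Set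
PosArc f I z j i = I j ≡ true × I i ≡ true ×
  (∃ λ x → Extends I z x × f (upd x j true) i ≡ true × f (upd x j false) i ≡ false)

NegArc : ∀ {n} → Network n → Subset n → Conf n → Fin n → Fin n → Set
NegArc f I z j i = I j ≡ true × I i ≡ true ×
  (∃ λ x → Extends I z x × f (upd x j true) i ≡ false × f (upd x j false) i ≡ true)

Arc : ∀ {n} → Network n → Subset n → Conf n → Fin n → Fin n → Set
Arc f I z j i = PosArc f I z j i ⊎ NegArc f I z j i

next : ∀ {k} → Fin (suc k) → Fin (suc k)
next {k} t = fromℕ< (m%n<n (suc (toℕ t)) (suc k))

countTrue : ∀ {m} → (Fin m → Bool) → ℕ
countTrue {m} s = sum (map (λ t → if s t then 1 else 0) (allFin m))

-- The subnetwork h induced by (I , z) is circular with the given parity of the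
-- number of negative arcs (0 = positive-circular, 1 = negative-circular):
--  * G(h) has at most one arc from any vertex to any vertex;
--  * the underlying digraph is a directed cycle v₀ → v₁ → … → v_k → v₀ through
--    all of I (v an enumeration of I; a loop if |I| = 1);
--  * s t records the sign of the arc v_t → v_{t+1} (true = negative), and the
--    number of negative arcs has the given parity.
Circular : ∀ {n} → ℕ → Network n → Subset n → Conf n → Set
Circular {n} parity f I z =
  (∀ j i → ¬ (PosArc f I z j i × NegArc f I z j i)) ×
  Σ ℕ λ k → Σ (Fin (suc k) → Fin n) λ v →
    Injective _≡_ _≡_ v ×
    (∀ i → I i ≡ true → ∃ λ t → v t ≡ i) ×
    (∀ t → I (v t) ≡ true) ×
    (∀ t u → Arc f I z (v t) (v u) → u ≡ next t) ×
    Σ (Fin (suc k) → Bool) λ s →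
      (∀ t → if s t then NegArc f I z (v t) (v (next t))
                    else PosArc f I z (v t) (v (next t))) ×
      countTrue s % 2 ≡ parity

PositiveCircular : ∀ {n} → Network n → Subset n → Conf n → Set
PositiveCircular = Circular 0

NegativeCircular : ∀ {n} → Network n → Subset n → Conf n → Set
NegativeCircular = Circular 1

module Submission where

-- Left to right in both parts: non-expansiveness makes each vertex of a circular subnetwork depend only on
-- its predecessor, so the subnetwork is a signed cyclic shift u (v (t+1)) = u (v t) xor s t; its fixed points
-- are obtained by integrating s around the cycle: two if s has even parity, none if odd.
--
-- Right to left: let x and y be fixed points of a subnetwork of g = f ⊕ e that are complementary on D. For u
-- agreeing with x off D, the distances from g u to x and to y are non-increasing and add up to |D|, so both are
-- preserved. Hence g (x flipped at k) differs from x at a single vertex σ k of D, and flipping u at k forces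
-- g u to differ from x at σ k. Following σ from j ∈ D reaches a σ-cycle C on which g acts as a signed cyclic
-- shift; if C misses j, x flipped on C is again fixed and we recurse on D ∖ C. The cycle through j is a circular
-- subnetwork of f whose parity is that of e along it. Two distinct fixed points give such a pair with e = 0,
-- hence a positive-circular subnetwork; a subnetwork without fixed points yields, by induction on |I|, two
-- solutions with some j ∈ I frozen to either value, which form such a pair with e the indicator of j, hence a
-- negative-circular subnetwork.

open import Defs
open import Algebra.Bundles using (CommutativeMonoid; CommutativeRing)
import Algebra.Properties.CommutativeMonoid.Sum as CommutativeMonoidSum
open import Data.Bool using (Bool; true; false; not; _∧_; _xor_; if_then_else_)
open import Data.Bool.Properties
  using (∧-zeroʳ; ∧-identityʳ; not-¬; ¬-not; not-distribˡ-xor;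
         xor-same; xor-identityʳ; xor-assoc; xor-comm; xor-∧-commutativeRing)
  renaming (_≟_ to _≟ᵇ_)
open import Data.Fin using (Fin; zero; suc; toℕ; fromℕ; inject₁; _≟_)
open import Data.Fin.Properties as Fin
  using (toℕ-injective; toℕ-fromℕ<; toℕ-inject₁; toℕ-fromℕ; toℕ<n; any?)
import Data.List as List using (map; allFin; tabulate)
open import Data.List.Properties using (map-tabulate)
import Data.Nat.ListAction as List using (sum)
open import Data.Nat using (ℕ; zero; suc; _+_; _≤_; _<_; _%_; z≤n; s≤s; s≤s⁻¹) renaming (_≟_ to _≟ℕ_)
open import Data.Nat.DivMod using (%-distribˡ-+; n%n≡0; m<n⇒m%n≡m)
open import Data.Nat.Properties
  using (+-0-commutativeMonoid; ≤-refl; ≤-reflexive; ≤-trans; ≤-antisym; <-≤-trans; <-cmp; n<1+n; 1+n≰n;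
         m≤m+n; m≤n+m; n≢0⇒n>0; n≤0⇒n≡0; +-comm; +-suc; +-identityʳ; suc-injective;
         +-mono-≤; +-mono-<-≤; +-mono-≤-<; +-monoʳ-≤; +-monoʳ-<; +-cancelʳ-≤;
         anyUpTo?; m≤n⇒∃[o]m+o≡n; module ≤-Reasoning)
open import Data.Product using (Σ; ∃; _×_; _,_; proj₁; proj₂; uncurry)
open import Data.Sum using (_⊎_; inj₁; inj₂)
open import Data.Vec.Functional using (init)
open import Function using (_∘_)
open import Function.Bundles using (_⇔_; mk⇔)
open import Function.Definitions using (Injective)
open import Relation.Binary.Definitions using (tri<; tri≈; tri>)
open import Relation.Binary.PropositionalEquality
  using (_≡_; _≢_; _≗_; refl; sym; trans; cong; cong₂; subst; module ≡-Reasoning)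
open import Relation.Nullary using (Dec; ¬_; does; yes; no; contradiction; ¬?)
open import Relation.Nullary.Decidable using (dec-true; dec-false; decidable-stable; _×-dec_)
import Relation.Unary as U

𝟙 : Bool → ℕ
𝟙 b = if b then 1 else 0

false≢true : false ≢ true
false≢true ()

𝟙-injective : ∀ {a b} → 𝟙 a ≡ 𝟙 b → a ≡ b
𝟙-injective {false} {false} _ = refl
𝟙-injective {true}  {true}  _ = refl

𝟙-∧-xor-same : ∀ d {a b} → a ≡ b → 𝟙 (d ∧ (a xor b)) ≡ 0
𝟙-∧-xor-same d {b = b} refl = cong 𝟙 (trans (cong (d ∧_) (xor-same b)) (∧-zeroʳ d))

xor-differ : ∀ {a b} → a ≢ b → a xor b ≡ true
xor-differ {false} {false} a≢b = contradiction refl a≢b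
xor-differ {false} {true}  a≢b = refl
xor-differ {true}  {false} a≢b = refl
xor-differ {true}  {true}  a≢b = contradiction refl a≢b

𝟙-xor≡0 : ∀ {a b} → 𝟙 (a xor b) ≡ 0 → a ≡ b
𝟙-xor≡0 {false} {false} _ = refl
𝟙-xor≡0 {true}  {true}  _ = refl

xor-cancelˡ : ∀ a b → a xor (a xor b) ≡ b
xor-cancelˡ a b = trans (sym (xor-assoc a a b)) (cong (_xor b) (xor-same a))

xor-cancelʳ : ∀ a b → (a xor b) xor b ≡ a
xor-cancelʳ a b = trans (xor-assoc a b b) (trans (cong (a xor_) (xor-same b)) (xor-identityʳ a))

xor-solve : ∀ a b s → b ≡ a xor s → s ≡ a xor b
xor-solve a b s eq = trans (sym (xor-cancelˡ a s)) (cong (a xor_) (sym eq))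

≢-xor : ∀ {p q r s} → p ≢ q → r ≢ s → p ≡ r xor (s xor q)
≢-xor {p} {q} {r} {s} p≢q r≢s = begin
  p                     ≡⟨ ¬-not p≢q ⟩
  not q                 ≡⟨ cong not (xor-cancelˡ s q) ⟨
  not (s xor (s xor q)) ≡⟨ not-distribˡ-xor s (s xor q) ⟩
  not s xor (s xor q)   ≡⟨ cong (_xor (s xor q)) (¬-not r≢s) ⟨
  r xor (s xor q)       ∎
  where open ≡-Reasoning

flip-sensitive : (P : Bool → Bool) {a b : Bool} → a ≢ b → P a ≢ P b → P true ≢ P false
flip-sensitive P {false} {false} a≢b = contradiction refl a≢b
flip-sensitive P {false} {true}  a≢b = _∘ sym
flip-sensitive P {true}  {false} a≢b = λ Pa≢Pb → Pa≢Pb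
flip-sensitive P {true}  {true}  a≢b = contradiction refl a≢b

-- The cyclic successor and orbits

data LastOrInject₁ : ∀ {k} → Fin (suc k) → Set where
  last   : ∀ {k} → LastOrInject₁ (fromℕ k)
  inject : ∀ {k} (t : Fin k) → LastOrInject₁ (inject₁ t)

lastOrInject₁ : ∀ {k} (t : Fin (suc k)) → LastOrInject₁ t
lastOrInject₁ {zero}  zero    = last
lastOrInject₁ {suc k} zero    = inject zero
lastOrInject₁ {suc k} (suc t) with lastOrInject₁ t
... | last     = last
... | inject s = inject (suc s)

next-inject₁ : ∀ {k} (t : Fin k) → next (inject₁ t) ≡ suc t
next-inject₁ {k} t = toℕ-injective (begin
  toℕ (next (inject₁ t))        ≡⟨ toℕ-fromℕ< _ ⟩
  suc (toℕ (inject₁ t)) % suc k ≡⟨ cong (λ m → suc m % suc k) (toℕ-inject₁ t) ⟩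
  suc (toℕ t) % suc k           ≡⟨ m<n⇒m%n≡m (s≤s (toℕ<n t)) ⟩
  suc (toℕ t)                   ∎)
  where open ≡-Reasoning

next-fromℕ : ∀ k → next (fromℕ k) ≡ zero
next-fromℕ k = toℕ-injective (begin
  toℕ (next (fromℕ k))        ≡⟨ toℕ-fromℕ< _ ⟩
  suc (toℕ (fromℕ k)) % suc k ≡⟨ cong (λ m → suc m % suc k) (toℕ-fromℕ k) ⟩
  suc k % suc k               ≡⟨ n%n≡0 (suc k) ⟩
  0                           ∎)
  where open ≡-Reasoning

next-injective : ∀ {k} → Injective _≡_ _≡_ (next {k})
next-injective {k} {t} {t′} eq with lastOrInject₁ t | lastOrInject₁ t′
... | last     | last      = refl
... | last     | inject s′ = contradiction (trans (sym (next-fromℕ k)) (trans eq (next-inject₁ s′))) Fin.0≢1+n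
... | inject s | last      = contradiction (trans (sym (next-fromℕ k)) (trans (sym eq) (next-inject₁ s))) Fin.0≢1+n
... | inject s | inject s′ = cong inject₁ (Fin.suc-injective (trans (sym (next-inject₁ s)) (trans eq (next-inject₁ s′))))

next-surjective : ∀ {k} (t : Fin (suc k)) → ∃ λ t′ → next t′ ≡ t
next-surjective {k}     zero    = fromℕ k , next-fromℕ k
next-surjective {suc k} (suc t) = inject₁ t , next-inject₁ t

least : ∀ {p} {P : ℕ → Set p} → U.Decidable P → ∀ {m} → P m → ∃ λ b → P b × (∀ {b′} → b′ < b → ¬ P b′)
least {P = P} P? {m} Pm = below (suc m) (m , ≤-refl , Pm)
  where
  below : ∀ B → (∃ λ b → b < B × P b) → ∃ λ b → P b × (∀ {b′} → b′ < b → ¬ P b′)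
  below zero    (_ , () , _)
  below (suc B) found with anyUpTo? P? B
  ... | yes found′ = below B found′
  ... | no  none   = let (b , b<1+B , Pb) = found in
    b , Pb , λ b′<b Pb′ → none (_ , <-≤-trans b′<b (s≤s⁻¹ b<1+B) , Pb′)

firstRepetition : ∀ {n} (w : ℕ → Fin n) →
  ∃ λ a → ∃ λ b → a < b × w a ≡ w b × (∀ {p q} → p < q → q < b → w p ≢ w q)
firstRepetition {n} w
  with i , i′ , i<i′ , eq ← Fin.pigeonhole (n<1+n n) (w ∘ toℕ)
  with b , (a , a<b , wa≡wb) , minimal ← least (λ b → anyUpTo? (λ a → w a ≟ w b) b) (toℕ i , i<i′ , eq)
  = a , b , a<b , wa≡wb , λ p<q q<b wp≡wq → minimal q<b (_ , p<q , wp≡wq)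

iterate : ∀ {n} → (Fin n → Fin n) → ℕ → Fin n → Fin n
iterate σ zero    j = j
iterate σ (suc m) j = σ (iterate σ m j)

CycleReached : ∀ {n p} → (Fin n → Fin n) → (Fin n → Set p) → Fin n → Set p
CycleReached {n} σ P j = ∃ λ k → Σ (Fin (suc k) → Fin n) λ v →
  Injective _≡_ _≡_ v × (∀ t → σ (v t) ≡ v (next t)) × (∀ t → P (v t)) × (v zero ≡ j ⊎ (∀ t → v t ≢ j))

orbit-cycle : ∀ {n p} (σ : Fin n → Fin n) (P : Fin n → Set p) → (∀ {i} → P i → P (σ i)) → ∀ {j} → P j →
              CycleReached σ P j
orbit-cycle σ P σ-preserves {j} Pj
  with a , b , a<b , wa≡wb , distinct ← firstRepetition (λ m → iterate σ m j)
  with k , a+1+k≡b ← m≤n⇒∃[o]m+o≡n a<b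
  = k , v , v-injective , v-succ , (λ t → w-preserves (a + toℕ t)) , start
  where
  w : ℕ → _
  w m = iterate σ m j
  w-preserves : ∀ m → P (w m)
  w-preserves zero    = Pj
  w-preserves (suc m) = σ-preserves (w-preserves m)
  v : Fin (suc k) → _
  v t = w (a + toℕ t)
  in-range : ∀ t → a + toℕ t < b
  in-range t = subst (a + toℕ t <_) a+1+k≡b (+-suc-mono-< t)
    where
    +-suc-mono-< : ∀ t → a + toℕ t < suc a + k
    +-suc-mono-< t = subst (a + toℕ t <_) (+-suc a k) (+-monoʳ-< a (toℕ<n t))
  v-injective : Injective _≡_ _≡_ v
  v-injective {t} {t′} eq with <-cmp (toℕ t) (toℕ t′)
  ... | tri< t<t′ _ _ = contradiction eq (distinct (+-monoʳ-< a t<t′) (in-range t′))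
  ... | tri≈ _ t≡t′ _ = toℕ-injective t≡t′
  ... | tri> _ _ t>t′ = contradiction (sym eq) (distinct (+-monoʳ-< a t>t′) (in-range t))
  v-succ : ∀ t → σ (v t) ≡ v (next t)
  v-succ t with lastOrInject₁ t
  ... | inject t′ = trans (cong (λ m → w (suc (a + m))) (toℕ-inject₁ t′))
                          (trans (cong w (sym (+-suc a (toℕ t′)))) (cong v (sym (next-inject₁ t′))))
  ... | last = begin
    w (suc (a + toℕ (fromℕ k)))   ≡⟨ cong (λ m → w (suc (a + m))) (toℕ-fromℕ k) ⟩
    w (suc a + k)                 ≡⟨ cong w a+1+k≡b ⟩
    w b                           ≡⟨ wa≡wb ⟨
    w a                           ≡⟨ cong w (+-identityʳ a) ⟨
    v zero                        ≡⟨ cong v (next-fromℕ k) ⟨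
    v (next (fromℕ k))            ∎
    where open ≡-Reasoning
  start : v zero ≡ j ⊎ (∀ t → v t ≢ j)
  start with a ≟ℕ 0
  ... | yes a≡0 = inj₁ (cong w (trans (+-identityʳ a) a≡0))
  ... | no  a≢0 = inj₂ λ t vt≡j →
    distinct (<-≤-trans (n≢0⇒n>0 a≢0) (m≤m+n a (toℕ t))) (in-range t) (sym vt≡j)

-- Sums and parities

module _ {c ℓ} (M : CommutativeMonoid c ℓ) where
  open CommutativeMonoid M
  open CommutativeMonoidSum M using (sum; sum-init-last; sum-cong-≗)
  open import Relation.Binary.Reasoning.Setoid setoid

  sum-∘next : ∀ {k} (h : Fin (suc k) → Carrier) → sum (h ∘ next) ≈ sum h
  sum-∘next {k} h = begin
    sum (h ∘ next)                   ≈⟨ sum-init-last (h ∘ next) ⟩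
    sum (init (h ∘ next)) ∙ h (next (fromℕ k)) ≡⟨ cong₂ _∙_ (sum-cong-≗ (cong h ∘ next-inject₁)) (cong h (next-fromℕ k)) ⟩
    sum (h ∘ suc) ∙ h zero            ≈⟨ comm _ _ ⟩
    sum h                             ∎

module ℕ-Sum = CommutativeMonoidSum +-0-commutativeMonoid
open ℕ-Sum using (sum; ∑-distrib-+)

listSum-allFin : ∀ {m} (h : Fin m → ℕ) → List.sum (List.map h (List.allFin m)) ≡ sum h
listSum-allFin {zero}  h = refl
listSum-allFin {suc m} h = cong (h zero +_) (begin
  List.sum (List.map h (List.tabulate suc))             ≡⟨ cong List.sum (map-tabulate suc h) ⟩
  List.sum (List.tabulate (h ∘ suc))                    ≡⟨ cong List.sum (map-tabulate (λ i → i) (h ∘ suc)) ⟨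
  List.sum (List.map (h ∘ suc) (List.allFin m))         ≡⟨ listSum-allFin (h ∘ suc) ⟩
  sum (h ∘ suc)                                         ∎)
  where open ≡-Reasoning

sum-cong : ∀ {m} {h h′ : Fin m → ℕ} → h ≗ h′ → sum h ≡ sum h′
sum-cong = ℕ-Sum.sum-cong-≗

sum-mono-≤ : ∀ {m} {h h′ : Fin m → ℕ} → (∀ i → h i ≤ h′ i) → sum h ≤ sum h′
sum-mono-≤ {zero}  le = z≤n
sum-mono-≤ {suc m} le = +-mono-≤ (le zero) (sum-mono-≤ (le ∘ suc))

sum-mono-< : ∀ {m} {h h′ : Fin m → ℕ} → (∀ i → h i ≤ h′ i) → ∀ c → h c < h′ c → sum h < sum h′
sum-mono-< le zero    lt = +-mono-<-≤ lt (sum-mono-≤ (le ∘ suc))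
sum-mono-< le (suc c) lt = +-mono-≤-< (le zero) (sum-mono-< (le ∘ suc) c lt)

lookup≤sum : ∀ {m} (h : Fin m → ℕ) i → h i ≤ sum h
lookup≤sum h zero    = m≤m+n (h zero) _
lookup≤sum h (suc i) = ≤-trans (lookup≤sum (h ∘ suc) i) (m≤n+m _ (h zero))

lookup+lookup≤sum : ∀ {m} (h : Fin m → ℕ) {i j} → i ≢ j → h i + h j ≤ sum h
lookup+lookup≤sum h {zero}  {zero}  i≢j = contradiction refl i≢j
lookup+lookup≤sum h {zero}  {suc j} i≢j = +-monoʳ-≤ (h zero) (lookup≤sum (h ∘ suc) j)
lookup+lookup≤sum h {suc i} {zero}  i≢j =
  subst (_≤ sum h) (+-comm (h zero) (h (suc i))) (+-monoʳ-≤ (h zero) (lookup≤sum (h ∘ suc) i))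
lookup+lookup≤sum h {suc i} {suc j} i≢j =
  ≤-trans (lookup+lookup≤sum (h ∘ suc) (i≢j ∘ cong suc)) (m≤n+m _ (h zero))

sum≡0⇒lookup≡0 : ∀ {m} (h : Fin m → ℕ) → sum h ≡ 0 → ∀ i → h i ≡ 0
sum≡0⇒lookup≡0 h eq i = n≤0⇒n≡0 (subst (h i ≤_) eq (lookup≤sum h i))

lookup≡0⇒sum≡0 : ∀ {m} (h : Fin m → ℕ) → (∀ i → h i ≡ 0) → sum h ≡ 0
lookup≡0⇒sum≡0 {zero}  h eq = refl
lookup≡0⇒sum≡0 {suc m} h eq = cong₂ _+_ (eq zero) (lookup≡0⇒sum≡0 (h ∘ suc) (eq ∘ suc))

sum-suc-at : ∀ {m} (h h′ : Fin m → ℕ) c → h′ c ≡ suc (h c) → (∀ i → i ≢ c → h′ i ≡ h i) →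
             sum h′ ≡ suc (sum h)
sum-suc-at h h′ zero    eq rest = cong₂ _+_ eq (sum-cong (λ i → rest (suc i) (Fin.0≢1+n ∘ sym)))
sum-suc-at h h′ (suc c) eq rest = trans
  (cong₂ _+_ (rest zero Fin.0≢1+n) (sum-suc-at (h ∘ suc) (h′ ∘ suc) c eq (λ i i≢c → rest (suc i) (i≢c ∘ Fin.suc-injective))))
  (+-suc (h zero) _)

xor-commutativeMonoid : CommutativeMonoid _ _
xor-commutativeMonoid = CommutativeRing.+-commutativeMonoid xor-∧-commutativeRing

module ⊕-Sum = CommutativeMonoidSum xor-commutativeMonoid

parity : ∀ {m} → (Fin m → Bool) → Bool
parity = ⊕-Sum.sum

parity-xor : ∀ {m} (p q : Fin m → Bool) → parity (λ t → p t xor q t) ≡ parity p xor parity q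
parity-xor = ⊕-Sum.∑-distrib-+

parity-differences : ∀ {k} (a : Fin (suc k) → Bool) → parity (λ t → a t xor a (next t)) ≡ false
parity-differences a = begin
  parity (λ t → a t xor a (next t)) ≡⟨ parity-xor a (a ∘ next) ⟩
  parity a xor parity (a ∘ next)    ≡⟨ cong (parity a xor_) (sum-∘next xor-commutativeMonoid a) ⟩
  parity a xor parity a             ≡⟨ xor-same (parity a) ⟩
  false                             ∎
  where open ≡-Reasoning

parity-allFalse : ∀ {m} (p : Fin m → Bool) → (∀ t → p t ≡ false) → parity p ≡ false
parity-allFalse {zero}  p all = refl
parity-allFalse {suc m} p all = cong₂ _xor_ (all zero) (parity-allFalse (p ∘ suc) (all ∘ suc))

parity-unique : ∀ {m} (p : Fin m → Bool) c → p c ≡ true → (∀ t → t ≢ c → p t ≡ false) → parity p ≡ true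
parity-unique p zero    pc rest = cong₂ _xor_ pc (parity-allFalse (p ∘ suc) (λ t → rest (suc t) (Fin.0≢1+n ∘ sym)))
parity-unique p (suc c) pc rest =
  cong₂ _xor_ (rest zero Fin.0≢1+n) (parity-unique (p ∘ suc) c pc (λ t t≢c → rest (suc t) (t≢c ∘ Fin.suc-injective)))

countTrue%2 : ∀ {m} (s : Fin m → Bool) → countTrue s % 2 ≡ 𝟙 (parity s)
countTrue%2 s = trans (cong (_% 2) (listSum-allFin (𝟙 ∘ s))) (go s)
  where
  𝟙+𝟙%2 : ∀ a b → (𝟙 a % 2 + 𝟙 b) % 2 ≡ 𝟙 (a xor b)
  𝟙+𝟙%2 false false = refl
  𝟙+𝟙%2 false true  = refl
  𝟙+𝟙%2 true  false = refl
  𝟙+𝟙%2 true  true  = refl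
  go : ∀ {m} (s : Fin m → Bool) → sum (𝟙 ∘ s) % 2 ≡ 𝟙 (parity s)
  go {zero}  s = refl
  go {suc m} s = begin
    (𝟙 (s zero) + sum (𝟙 ∘ s ∘ suc)) % 2             ≡⟨ %-distribˡ-+ (𝟙 (s zero)) _ 2 ⟩
    (𝟙 (s zero) % 2 + sum (𝟙 ∘ s ∘ suc) % 2) % 2     ≡⟨ cong (λ r → (𝟙 (s zero) % 2 + r) % 2) (go (s ∘ suc)) ⟩
    (𝟙 (s zero) % 2 + 𝟙 (parity (s ∘ suc))) % 2      ≡⟨ 𝟙+𝟙%2 (s zero) _ ⟩
    𝟙 (parity s)                                      ∎
    where open ≡-Reasoning

prefixParity : ∀ {m} → (Fin m → Bool) → Bool → Fin (suc m) → Bool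
prefixParity s c zero    = c
prefixParity {suc m} s c (suc t) = prefixParity (s ∘ suc) (c xor s zero) t

prefixParity-suc : ∀ {m} (s : Fin m → Bool) c t →
                   prefixParity s c (suc t) ≡ prefixParity s c (inject₁ t) xor s t
prefixParity-suc {suc m} s c zero    = refl
prefixParity-suc {suc m} s c (suc t) = prefixParity-suc (s ∘ suc) (c xor s zero) t

prefixParity-last : ∀ {m} (s : Fin m → Bool) c → prefixParity s c (fromℕ m) ≡ c xor parity s
prefixParity-last {zero}  s c = sym (xor-identityʳ c)
prefixParity-last {suc m} s c =
  trans (prefixParity-last (s ∘ suc) (c xor s zero)) (xor-assoc c (s zero) _)

integrate : ∀ {k} → (Fin (suc k) → Bool) → Bool → Fin (suc k) → Bool
integrate s c t = prefixParity s c (inject₁ t)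

integrate-next : ∀ {k} (s : Fin (suc k) → Bool) → parity s ≡ false → ∀ c t →
                 integrate s c (next t) ≡ integrate s c t xor s t
integrate-next {k} s even c t with lastOrInject₁ t
... | inject t′ = trans (cong (integrate s c) (next-inject₁ t′)) (prefixParity-suc s c (inject₁ t′))
... | last = begin
  integrate s c (next (fromℕ k))        ≡⟨ cong (integrate s c) (next-fromℕ k) ⟩
  c                                     ≡⟨ xor-identityʳ c ⟨
  c xor false                           ≡⟨ cong (c xor_) even ⟨
  c xor parity s                        ≡⟨ prefixParity-last s c ⟨
  prefixParity s c (suc (fromℕ k))      ≡⟨ prefixParity-suc s c (fromℕ k) ⟩
  integrate s c (fromℕ k) xor s (fromℕ k) ∎
  where open ≡-Reasoning

-- Configurations and the restricted Hamming distance

upd-same : ∀ {n} (u : Conf n) k α → upd u k α k ≡ α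
upd-same u k α = cong (if_then α else u k) (dec-true (k ≟ k) refl)

upd-other : ∀ {n} (u : Conf n) k α {i} → i ≢ k → upd u k α i ≡ u i
upd-other u k α {i} i≢k = cong (if_then α else u i) (dec-false (i ≟ k) i≢k)

upd-self : ∀ {n} (u : Conf n) k → upd u k (u k) ≗ u
upd-self u k i with i ≟ k
... | yes refl = refl
... | no  _    = refl

count : ∀ {m} → (Fin m → Bool) → ℕ
count D = sum (𝟙 ∘ D)

count>0 : ∀ {m} (D : Fin m → Bool) {j} → D j ≡ true → 0 < count D
count>0 D {j} Dj = subst (_≤ count D) (cong 𝟙 Dj) (lookup≤sum (𝟙 ∘ D) j)

_∖_ : ∀ {m} → (Fin m → Bool) → (Fin m → Bool) → Fin m → Bool
(D ∖ E) i = D i ∧ not (E i)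

∖⊆ : ∀ {m} (D E : Fin m → Bool) {i} → (D ∖ E) i ≡ true → D i ≡ true
∖⊆ D E {i} _ with D i
... | true = refl

count-∖< : ∀ {m} (D E : Fin m → Bool) {c} → D c ≡ true → E c ≡ true → count (D ∖ E) < count D
count-∖< D E {c} Dc Ec = sum-mono-< pointwise c at-c
  where
  pointwise : ∀ i → 𝟙 ((D ∖ E) i) ≤ 𝟙 (D i)
  pointwise i with D i | E i
  ... | false | _     = z≤n
  ... | true  | false = ≤-refl
  ... | true  | true  = z≤n
  at-c : 𝟙 ((D ∖ E) c) < 𝟙 (D c)
  at-c rewrite Dc | Ec = s≤s z≤n

dist : ∀ {n} → Subset n → Conf n → Conf n → ℕ
dist D a b = sum λ i → 𝟙 (D i ∧ (a i xor b i))

module _ {n} (D : Subset n) where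

  dist-comm : ∀ a b → dist D a b ≡ dist D b a
  dist-comm a b = sum-cong λ i → cong (λ q → 𝟙 (D i ∧ q)) (xor-comm (a i) (b i))

  dist-congʳ : ∀ a {b b′} → (∀ i → D i ≡ true → b i ≡ b′ i) → dist D a b ≡ dist D a b′
  dist-congʳ a {b} {b′} eq = sum-cong pointwise
    where
    pointwise : ∀ i → 𝟙 (D i ∧ (a i xor b i)) ≡ 𝟙 (D i ∧ (a i xor b′ i))
    pointwise i with D i in Di
    ... | false = refl
    ... | true  = cong (λ q → 𝟙 (a i xor q)) (eq i Di)

  dist≡0⇒agree : ∀ a b → dist D a b ≡ 0 → ∀ i → D i ≡ true → a i ≡ b i
  dist≡0⇒agree a b d≡0 i Di = 𝟙-xor≡0 (subst (λ d → 𝟙 (d ∧ (a i xor b i)) ≡ 0) Di (sum≡0⇒lookup≡0 _ d≡0 i))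

  agree⇒dist≡0 : ∀ a b → (∀ i → D i ≡ true → a i ≡ b i) → dist D a b ≡ 0
  agree⇒dist≡0 a b eq = lookup≡0⇒sum≡0 _ pointwise
    where
    pointwise : ∀ i → 𝟙 (D i ∧ (a i xor b i)) ≡ 0
    pointwise i with D i in Di
    ... | false = refl
    ... | true  = 𝟙-∧-xor-same true (eq i Di)

  dist-suc-at : ∀ a b b′ c → D c ≡ true → a c ≡ b c → b′ c ≢ b c →
                (∀ i → D i ≡ true → i ≢ c → b′ i ≡ b i) → dist D a b′ ≡ suc (dist D a b)
  dist-suc-at a b b′ c Dc ac≡bc b′c≢bc rest = sum-suc-at _ _ c at-c elsewhere
    where
    at-c : 𝟙 (D c ∧ (a c xor b′ c)) ≡ suc (𝟙 (D c ∧ (a c xor b c)))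
    at-c rewrite Dc = trans (cong 𝟙 (xor-differ (λ eq → b′c≢bc (trans (sym eq) ac≡bc))))
                            (cong suc (sym (𝟙-∧-xor-same true ac≡bc)))
    elsewhere : ∀ i → i ≢ c → 𝟙 (D i ∧ (a i xor b′ i)) ≡ 𝟙 (D i ∧ (a i xor b i))
    elsewhere i i≢c with D i in Di
    ... | false = refl
    ... | true  = cong (λ q → 𝟙 (a i xor q)) (rest i Di i≢c)

  dist≤1⇒unique-difference : ∀ a b {p} → dist D a b ≤ 1 → D p ≡ true → a p ≢ b p →
                              ∀ i → D i ≡ true → i ≢ p → a i ≡ b i
  dist≤1⇒unique-difference a b {p} d≤1 Dp ap≢bp i Di i≢p with a i ≟ᵇ b i
  ... | yes ai≡bi = ai≡bi
  ... | no  ai≢bi = contradiction (≤-trans two≤dist d≤1) λ { (s≤s ()) }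
    where
    mismatch : ∀ {j} → D j ≡ true → a j ≢ b j → 𝟙 (D j ∧ (a j xor b j)) ≡ 1
    mismatch Dj aj≢bj rewrite Dj = cong 𝟙 (xor-differ aj≢bj)
    two≤dist : 2 ≤ dist D a b
    two≤dist = subst (_≤ dist D a b) (cong₂ _+_ (mismatch Di ai≢bi) (mismatch Dp ap≢bp))
                     (lookup+lookup≤sum _ i≢p)

  difference : ∀ a b {N} → dist D a b ≡ suc N → ∃ λ c → D c ≡ true × a c ≢ b c
  difference a b d≡suc with any? (λ c → (D c ≟ᵇ true) ×-dec ¬? (a c ≟ᵇ b c))
  ... | yes found = found
  ... | no  none  = contradiction
    (trans (sym d≡suc) (agree⇒dist≡0 a b λ i Di → decidable-stable (a i ≟ᵇ b i) λ ai≢bi → none (i , Di , ai≢bi)))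
    λ ()

hamming≡sum : ∀ {n} (a b : Conf n) → hamming a b ≡ sum (λ i → bit≢ (a i) (b i))
hamming≡sum a b = listSum-allFin (λ i → bit≢ (a i) (b i))

bit≢≡𝟙-xor : ∀ a b → bit≢ a b ≡ 𝟙 (a xor b)
bit≢≡𝟙-xor false false = refl
bit≢≡𝟙-xor false true  = refl
bit≢≡𝟙-xor true  false = refl
bit≢≡𝟙-xor true  true  = refl

dist≤hamming : ∀ {n} (D : Subset n) a b → dist D a b ≤ hamming a b
dist≤hamming D a b = subst (dist D a b ≤_) (sym (hamming≡sum a b)) (sum-mono-≤ pointwise)
  where
  pointwise : ∀ i → 𝟙 (D i ∧ (a i xor b i)) ≤ bit≢ (a i) (b i)
  pointwise i with D i
  ... | false = z≤n
  ... | true  = subst (𝟙 (a i xor b i) ≤_) (sym (bit≢≡𝟙-xor (a i) (b i))) ≤-refl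

hamming≡dist : ∀ {n} (D : Subset n) a b → (∀ i → D i ≡ false → a i ≡ b i) → hamming a b ≡ dist D a b
hamming≡dist D a b off = trans (hamming≡sum a b) (sum-cong pointwise)
  where
  pointwise : ∀ i → bit≢ (a i) (b i) ≡ 𝟙 (D i ∧ (a i xor b i))
  pointwise i with D i in Di
  ... | false = trans (bit≢≡𝟙-xor (a i) (b i)) (𝟙-∧-xor-same true (off i Di))
  ... | true  = bit≢≡𝟙-xor (a i) (b i)

Congruent : ∀ {n} → Network n → Set
Congruent {n} f = ∀ (u u′ : Conf n) → u ≗ u′ → f u ≗ f u′

module _ {n} {g : Network n} (g-ne : NonExpansive g) where

  nonExpansive-dist : ∀ D u u′ → (∀ i → D i ≡ false → u i ≡ u′ i) → dist D (g u) (g u′) ≤ dist D u u′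
  nonExpansive-dist D u u′ off = begin
    dist D (g u) (g u′)   ≤⟨ dist≤hamming D (g u) (g u′) ⟩
    hamming (g u) (g u′)  ≤⟨ g-ne u u′ ⟩
    hamming u u′          ≡⟨ hamming≡dist D u u′ off ⟩
    dist D u u′           ∎
    where open ≤-Reasoning

  nonExpansive-cong : ∀ u u′ → u ≗ u′ → g u ≗ g u′
  nonExpansive-cong u u′ u≗u′ i = dist≡0⇒agree everywhere (g u) (g u′)
    (n≤0⇒n≡0 (≤-trans (nonExpansive-dist everywhere u u′ λ _ ()) (≤-reflexive (agree⇒dist≡0 everywhere u u′ λ i _ → u≗u′ i))))
    i refl
    where
    everywhere : Subset n
    everywhere _ = true

_⊕_ : ∀ {n} → Network n → Conf n → Network n
(f ⊕ e) u i = f u i xor e i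

nonExpansive-⊕ : ∀ {n} {f : Network n} → NonExpansive f → ∀ e → NonExpansive (f ⊕ e)
nonExpansive-⊕ {f = f} f-ne e u u′ = subst (_≤ hamming u u′) hamming-⊕ (f-ne u u′)
  where
  bit≢-xor : ∀ a b c → bit≢ a b ≡ bit≢ (a xor c) (b xor c)
  bit≢-xor a b false = cong₂ bit≢ (sym (xor-identityʳ a)) (sym (xor-identityʳ b))
  bit≢-xor false false true = refl
  bit≢-xor false true  true = refl
  bit≢-xor true  false true = refl
  bit≢-xor true  true  true = refl
  hamming-⊕ : hamming (f u) (f u′) ≡ hamming ((f ⊕ e) u) ((f ⊕ e) u′)
  hamming-⊕ = trans (hamming≡sum (f u) (f u′))
    (trans (sum-cong (λ i → bit≢-xor (f u i) (f u′ i) (e i))) (sym (hamming≡sum ((f ⊕ e) u) ((f ⊕ e) u′))))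

FixedOn : ∀ {n} → Network n → Subset n → Conf n → Set
FixedOn g D u = ∀ i → D i ≡ true → g u i ≡ u i

-- Arcs and cyclic shifts

image : ∀ {n k} → (Fin (suc k) → Fin n) → Subset n
image v i = does (any? λ t → v t ≟ i)

image-∋ : ∀ {n k} (v : Fin (suc k) → Fin n) t → image v (v t) ≡ true
image-∋ v t = dec-true (any? λ t′ → v t′ ≟ v t) (t , refl)

image-∌ : ∀ {n k} (v : Fin (suc k) → Fin n) {i} → (∀ t → v t ≢ i) → image v i ≡ false
image-∌ v {i} ∌ = dec-false (any? λ t → v t ≟ i) λ (t , vt≡i) → ∌ t vt≡i

image⇒preimage : ∀ {n k} (v : Fin (suc k) → Fin n) {i} → image v i ≡ true → ∃ λ t → v t ≡ i
image⇒preimage v {i} = go (any? λ t → v t ≟ i)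
  where
  go : (d : Dec (∃ λ t → v t ≡ i)) → does d ≡ true → ∃ λ t → v t ≡ i
  go (yes found) _ = found

Extends-upd : ∀ {n} {I : Subset n} {z x : Conf n} c α → I c ≡ true → Extends I z x → Extends I z (upd x c α)
Extends-upd {I = I} {x = x} c α Ic ext i Ii = trans (upd-other x c α λ i≡c → false≢true (trans (sym Ii) (trans (cong I i≡c) Ic))) (ext i Ii)

CyclicShift : ∀ {n k} → Network n → Subset n → Conf n → (Fin (suc k) → Fin n) → (Fin (suc k) → Bool) → Set
CyclicShift f I z v s = ∀ u → Extends I z u → ∀ t → f u (v (next t)) ≡ u (v t) xor s t

Sensitive : ∀ {n} → Network n → Subset n → Conf n → Fin n → Fin n → Set
Sensitive f I z j i = I j ≡ true × I i ≡ true ×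
  (∃ λ x → Extends I z x × f (upd x j true) i ≢ f (upd x j false) i)

sensitive⇒arc : ∀ {n} {f : Network n} {I z j i} → Sensitive f I z j i → Arc f I z j i
sensitive⇒arc {f = f} {j = j} {i} (Ij , Ii , x , ext , differ)
  with f (upd x j true) i in f1 | f (upd x j false) i in f0
... | true  | false = inj₁ (Ij , Ii , x , ext , f1 , f0)
... | false | true  = inj₂ (Ij , Ii , x , ext , f1 , f0)
... | true  | true  = contradiction refl differ
... | false | false = contradiction refl differ

arc⇒sensitive : ∀ {n} {f : Network n} {I z j i} → Arc f I z j i → Sensitive f I z j i
arc⇒sensitive (inj₁ (Ij , Ii , x , ext , f1 , f0)) = Ij , Ii , x , ext , λ eq → false≢true (sym (trans (sym f1) (trans eq f0)))
arc⇒sensitive (inj₂ (Ij , Ii , x , ext , f1 , f0)) = Ij , Ii , x , ext , λ eq → false≢true (trans (sym f1) (trans eq f0))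

arc-endpoints : ∀ {n} {f : Network n} {I z j i} → Arc f I z j i → I j ≡ true × I i ≡ true
arc-endpoints (inj₁ (Ij , Ii , _)) = Ij , Ii
arc-endpoints (inj₂ (Ij , Ii , _)) = Ij , Ii

inArcs-determine : ∀ {n} {f : Network n} → Congruent f → ∀ {I z i} → I i ≡ true →
                   ∀ u u′ → Extends I z u → Extends I z u′ →
                   (∀ c → Arc f I z c i → u c ≡ u′ c) → f u i ≡ f u′ i
inArcs-determine {f = f} f-cong {I} {z} {i} Ii u u′ ext ext′ inArcs = go _ u ext inArcs refl
  where
  go : ∀ N u → Extends I z u → (∀ c → Arc f I z c i → u c ≡ u′ c) → dist I u′ u ≡ N → f u i ≡ f u′ i
  go zero u ext inArcs d≡0 = f-cong u u′ u≗u′ i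
    where
    u≗u′ : u ≗ u′
    u≗u′ j with I j in Ij
    ... | true  = sym (dist≡0⇒agree I u′ u d≡0 j Ij)
    ... | false = trans (ext j Ij) (sym (ext′ j Ij))
  go (suc N) u ext inArcs d≡suc = trans flip-irrelevant (go N u″ ext″ inArcs″ d″≡N)
    where
    c-differs = difference I u′ u d≡suc
    c = proj₁ c-differs
    Ic = proj₁ (proj₂ c-differs)
    u′c≢uc = proj₂ (proj₂ c-differs)
    u″ = upd u c (u′ c)
    ext″ : Extends I z u″
    ext″ = Extends-upd c (u′ c) Ic ext
    inArcs″ : ∀ c′ → Arc f I z c′ i → u″ c′ ≡ u′ c′
    inArcs″ c′ arc with c′ ≟ c
    ... | yes refl = refl
    ... | no  _    = inArcs c′ arc
    d″≡N : dist I u′ u″ ≡ N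
    d″≡N = suc-injective (trans (sym (dist-suc-at I u′ u″ u c Ic (sym (upd-same u c (u′ c)))
             (λ eq → u′c≢uc (trans (sym (upd-same u c (u′ c))) (sym eq)))
             (λ j _ j≢c → sym (upd-other u c (u′ c) j≢c)))) d≡suc)
    flip-irrelevant : f u i ≡ f u″ i
    flip-irrelevant = decidable-stable (f u i ≟ᵇ f u″ i) λ differ →
      u′c≢uc (sym (inArcs c (sensitive⇒arc {f = f} (Ic , Ii , u , ext ,
        flip-sensitive (λ α → f (upd u c α) i) (u′c≢uc ∘ sym)
          (λ eq → differ (trans (f-cong u _ (sym ∘ upd-self u c) i) eq))))))

circular-shift : ∀ {n} {f : Network n} → Congruent f → ∀ {I z k} {v : Fin (suc k) → Fin n} {s} →
  (∀ i → I i ≡ true → ∃ λ t → v t ≡ i) → (∀ t → I (v t) ≡ true) →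
  (∀ t t′ → Arc f I z (v t) (v t′) → t′ ≡ next t) →
  (∀ t → if s t then NegArc f I z (v t) (v (next t)) else PosArc f I z (v t) (v (next t))) →
  CyclicShift f I z v s
circular-shift {f = f} f-cong {I} {z} {v = v} {s} cover onCycle arcs signs u ext t =
  signed (s t) (signs t)
  where
  from-arc : ∀ x α → Extends I z x → u (v t) ≡ α → f u (v (next t)) ≡ f (upd x (v t) α) (v (next t))
  from-arc x α ext-x uvt≡α = inArcs-determine f-cong (onCycle (next t)) u _ ext
    (Extends-upd (v t) α (onCycle t) ext-x) only-from-vt
    where
    only-from-vt : ∀ c → Arc f I z c (v (next t)) → u c ≡ upd x (v t) α c
    only-from-vt c arc with cover c (proj₁ (arc-endpoints {f = f} arc))
    ... | t′ , refl with next-injective (arcs t′ (next t) arc)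
    ... | refl = trans uvt≡α (sym (upd-same x (v t) α))
  signed : ∀ b → (if b then NegArc f I z (v t) (v (next t)) else PosArc f I z (v t) (v (next t))) →
           f u (v (next t)) ≡ u (v t) xor b
  signed true  (_ , _ , x , ext-x , f1 , f0) with u (v t) in uvt
  ... | true  = trans (from-arc x true  ext-x uvt) f1
  ... | false = trans (from-arc x false ext-x uvt) f0
  signed false (_ , _ , x , ext-x , f1 , f0) with u (v t) in uvt
  ... | true  = trans (from-arc x true  ext-x uvt) f1
  ... | false = trans (from-arc x false ext-x uvt) f0

module _ {n k} (v : Fin (suc k) → Fin n) (v-injective : Injective _≡_ _≡_ v) where

  cycleConf : (Fin (suc k) → Bool) → Conf n → Conf n
  cycleConf a z i = pick (any? λ t → v t ≟ i)
    where
    pick : Dec (∃ λ t → v t ≡ i) → Bool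
    pick (yes (t , _)) = a t
    pick (no  _)       = z i

  cycleConf-on : ∀ a z t → cycleConf a z (v t) ≡ a t
  cycleConf-on a z t with any? (λ t′ → v t′ ≟ v t)
  ... | yes (t′ , eq) = cong a (v-injective eq)
  ... | no  none      = contradiction (t , refl) none

  cycleConf-off : ∀ a z {i} → (∀ t → v t ≢ i) → cycleConf a z i ≡ z i
  cycleConf-off a z {i} off with any? (λ t → v t ≟ i)
  ... | yes (t , eq) = contradiction eq (off t)
  ... | no  _        = refl

module _ {n} {f : Network n} {I z k} {v : Fin (suc k) → Fin n} {s}
  (shift : CyclicShift f I z v s) (onCycle : ∀ t → I (v t) ≡ true) where

  fixed⇒signs : ∀ u → SubFixed f I z u → ∀ t → s t ≡ u (v t) xor u (v (next t))
  fixed⇒signs u (ext , fixed) t =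
    xor-solve (u (v t)) _ (s t) (trans (sym (fixed _ (onCycle (next t)))) (shift u ext t))

  oddShift⇒noFixed : parity s ≡ true → ∀ u → ¬ SubFixed f I z u
  oddShift⇒noFixed odd u fixed-u = false≢true (begin
    false                                  ≡⟨ parity-differences (u ∘ v) ⟨
    parity (λ t → u (v t) xor u (v (next t))) ≡⟨ ⊕-Sum.sum-cong-≗ (fixed⇒signs u fixed-u) ⟨
    parity s                               ≡⟨ odd ⟩
    true                                   ∎)
    where open ≡-Reasoning

  evenShift⇒twoFixed : Injective _≡_ _≡_ v → (∀ i → I i ≡ true → ∃ λ t → v t ≡ i) →
                       parity s ≡ false → ¬ AtMostOneFixed f I z
  evenShift⇒twoFixed v-injective cover even atMostOne = false≢true (begin
    false                    ≡⟨ cycleConf-on v v-injective (integrate s false) z zero ⟨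
    fixedFor false (v zero)  ≡⟨ atMostOne _ _ (fixed false) (fixed true) (v zero) (onCycle zero) ⟩
    fixedFor true (v zero)   ≡⟨ cycleConf-on v v-injective (integrate s true) z zero ⟩
    true                     ∎)
    where
    open ≡-Reasoning
    fixedFor : Bool → Conf n
    fixedFor c = cycleConf v v-injective (integrate s c) z
    extends : ∀ c → Extends I z (fixedFor c)
    extends c i Ii = cycleConf-off v v-injective (integrate s c) z λ t vt≡i →
      false≢true (trans (sym Ii) (trans (cong I (sym vt≡i)) (onCycle t)))
    fixed : ∀ c → SubFixed f I z (fixedFor c)
    fixed c = extends c , λ i Ii → fixed-at (cover i Ii)
      where
      fixed-at : ∀ {i} → (∃ λ t → v t ≡ i) → f (fixedFor c) i ≡ fixedFor c i
      fixed-at (t′ , refl) with next-surjective t′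
      ... | t , refl = begin
        f (fixedFor c) (v (next t))          ≡⟨ shift (fixedFor c) (extends c) t ⟩
        fixedFor c (v t) xor s t             ≡⟨ cong (_xor s t) (cycleConf-on v v-injective (integrate s c) z t) ⟩
        integrate s c t xor s t              ≡⟨ integrate-next s even c t ⟨
        integrate s c (next t)               ≡⟨ cycleConf-on v v-injective (integrate s c) z (next t) ⟨
        fixedFor c (v (next t))              ∎

module _ {n k} {f : Network n} {v : Fin (suc k) → Fin n} {z s}
  (v-injective : Injective _≡_ _≡_ v) (shift : CyclicShift f (image v) z v s) where

  private
    C = image v

  shift-upd : ∀ x → Extends C z x → ∀ t α → f (upd x (v t) α) (v (next t)) ≡ α xor s t
  shift-upd x ext t α =
    trans (shift _ (Extends-upd (v t) α (image-∋ v t) ext) t) (cong (_xor s t) (upd-same x (v t) α))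

  sensitive-source : ∀ j t → Sensitive f C z j (v (next t)) → j ≡ v t
  sensitive-source j t (Cj , _ , x , ext , differ) = decidable-stable (j ≟ v t) λ j≢vt →
    differ (begin
      f (upd x j true) (v (next t))    ≡⟨ shift _ (Extends-upd j true Cj ext) t ⟩
      upd x j true (v t) xor s t       ≡⟨ cong (_xor s t) (trans (upd-other x j true (j≢vt ∘ sym)) (sym (upd-other x j false (j≢vt ∘ sym)))) ⟩
      upd x j false (v t) xor s t      ≡⟨ shift _ (Extends-upd j false Cj ext) t ⟨
      f (upd x j false) (v (next t))   ∎)
    where open ≡-Reasoning

  arc-target : ∀ {j i} → Arc f C z j i → ∃ λ t → v (next t) ≡ i × j ≡ v t
  arc-target {j} {i} arc with image⇒preimage v (proj₂ (arc-endpoints {f = f} arc))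
  ... | t′ , refl with next-surjective t′
  ... | t , refl = t , refl , sensitive-source j t (arc⇒sensitive {f = f} arc)

  shift⇒circular : Circular (𝟙 (parity s)) f C z
  shift⇒circular =
    noBoth , k , v , v-injective , (λ i → image⇒preimage v) , image-∋ v ,
    arcs , s , signs , countTrue%2 s
    where
    noBoth : ∀ j i → ¬ (PosArc f C z j i × NegArc f C z j i)
    noBoth j i (pos , neg) with arc-target {j} {i} (inj₁ pos)
    ... | t , refl , refl = false≢true (trans (sym (sign (proj₂ (proj₂ pos)))) (sign (proj₂ (proj₂ neg))))
      where
      sign : ∀ {b b′} → (∃ λ x → Extends C z x × f (upd x (v t) true) (v (next t)) ≡ b′ × f (upd x (v t) false) (v (next t)) ≡ b) →
             s t ≡ b
      sign (x , ext , _ , f0) = trans (sym (shift-upd x ext t false)) f0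
    arcs : ∀ t t′ → Arc f C z (v t) (v t′) → t′ ≡ next t
    arcs t t′ arc with arc-target arc
    ... | t″ , vnt″≡vt′ , vt≡vt″ = trans (sym (v-injective vnt″≡vt′)) (cong next (sym (v-injective vt≡vt″)))
    signs : ∀ t → if s t then NegArc f C z (v t) (v (next t)) else PosArc f C z (v t) (v (next t))
    signs t with s t | shift-upd z (λ _ _ → refl) t true | shift-upd z (λ _ _ → refl) t false
    ... | true  | f1 | f0 = image-∋ v t , image-∋ v (next t) , z , (λ _ _ → refl) , f1 , f0
    ... | false | f1 | f0 = image-∋ v t , image-∋ v (next t) , z , (λ _ _ → refl) , f1 , f0

-- Fixed points complementary on D

module FixedPair {n} {g : Network n} (g-ne : NonExpansive g) (D : Subset n) (x y : Conf n)
  (y≗x⊕D : ∀ i → y i ≡ x i xor D i) (x-fixed : FixedOn g D x) (y-fixed : FixedOn g D y) where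

  dist-complement : ∀ a → dist D a x + dist D a y ≡ count D
  dist-complement a = trans (sym (∑-distrib-+ (λ i → 𝟙 (D i ∧ (a i xor x i))) (λ i → 𝟙 (D i ∧ (a i xor y i))))) (sum-cong pointwise)
    where
    pointwise : ∀ i → 𝟙 (D i ∧ (a i xor x i)) + 𝟙 (D i ∧ (a i xor y i)) ≡ 𝟙 (D i)
    pointwise i rewrite y≗x⊕D i with D i | a i | x i
    ... | false | _     | _     = refl
    ... | true  | false | false = refl
    ... | true  | false | true  = refl
    ... | true  | true  | false = refl
    ... | true  | true  | true  = refl

  -- Both distances to x and to y can only shrink under g, and they sum to |D|.
  dist-preserved : ∀ u → Extends D x u → dist D (g u) x ≡ dist D u x
  dist-preserved u ext = ≤-antisym to-x (+-cancelʳ-≤ _ _ _ (begin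
    dist D u x + dist D u y          ≡⟨ dist-complement u ⟩
    count D                          ≡⟨ dist-complement (g u) ⟨
    dist D (g u) x + dist D (g u) y  ≤⟨ +-monoʳ-≤ (dist D (g u) x) to-y ⟩
    dist D (g u) x + dist D u y      ∎))
    where
    open ≤-Reasoning
    toward : ∀ w → FixedOn g D w → Extends D w u → dist D (g u) w ≤ dist D u w
    toward w w-fixed ext-w = subst (_≤ dist D u w) (dist-congʳ D (g u) w-fixed)
      (nonExpansive-dist g-ne D u w ext-w)
    to-x = toward x x-fixed ext
    to-y = toward y y-fixed λ i Di → trans (ext i Di) (sym (trans (y≗x⊕D i) (trans (cong (x i xor_) Di) (xor-identityʳ (x i)))))

  flipAt : Fin n → Conf n
  flipAt k = upd x k (not (x k))

  flipAt-extends : ∀ {k} → D k ≡ true → Extends D x (flipAt k)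
  flipAt-extends {k} Dk i Di = upd-other x k _ λ i≡k → false≢true (trans (sym Di) (trans (cong D i≡k) Dk))

  dist-flipAt : ∀ {k} → D k ≡ true → dist D x (flipAt k) ≡ 1
  dist-flipAt {k} Dk = trans
    (dist-suc-at D x x (flipAt k) k Dk refl (λ eq → not-¬ refl (sym (trans (sym (upd-same x k _)) eq)))
      λ i _ i≢k → upd-other x k _ i≢k)
    (cong suc (agree⇒dist≡0 D x x λ _ _ → refl))

  dist-g-flipAt : ∀ {k} → D k ≡ true → dist D (g (flipAt k)) x ≡ 1
  dist-g-flipAt {k} Dk =
    trans (dist-preserved (flipAt k) (flipAt-extends Dk)) (trans (dist-comm D (flipAt k) x) (dist-flipAt Dk))

  -- The unique vertex of D at which g (flipAt k) differs from x (for k ∈ D; k itself is a junk value otherwise).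
  successor : Fin n → Fin n
  successor k = pick (any? λ i → (D i ≟ᵇ true) ×-dec ¬? (g (flipAt k) i ≟ᵇ x i))
    where
    pick : Dec (∃ λ i → D i ≡ true × g (flipAt k) i ≢ x i) → Fin n
    pick (yes (i , _)) = i
    pick (no  _)       = k

  successor-differs : ∀ {k} → D k ≡ true → D (successor k) ≡ true × g (flipAt k) (successor k) ≢ x (successor k)
  successor-differs {k} Dk with any? (λ i → (D i ≟ᵇ true) ×-dec ¬? (g (flipAt k) i ≟ᵇ x i))
  ... | yes (_ , differs) = differs
  ... | no  none          = contradiction (difference D (g (flipAt k)) x (dist-g-flipAt Dk)) none

  successor-unique : ∀ {k} → D k ≡ true → ∀ i → D i ≡ true → i ≢ successor k → g (flipAt k) i ≡ x i
  successor-unique {k} Dk = dist≤1⇒unique-difference D (g (flipAt k)) x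
    (≤-reflexive (dist-g-flipAt Dk))
    (proj₁ (successor-differs Dk)) (proj₂ (successor-differs Dk))

  -- Otherwise g u would be one step farther from g (flipAt k) than u is from flipAt k.
  successor-disagrees : ∀ u → Extends D x u → ∀ {k} → D k ≡ true → u k ≢ x k →
                        g u (successor k) ≢ x (successor k)
  successor-disagrees u ext {k} Dk uk≢xk guσ≡xσ = 1+n≰n (begin-strict
    dist D u (flipAt k)            <⟨ n<1+n _ ⟩
    suc (dist D u (flipAt k))      ≡⟨ dist-suc-at D u (flipAt k) x k Dk (trans (¬-not uk≢xk) (sym (upd-same x k _)))
                                        (λ eq → not-¬ refl (trans eq (upd-same x k _)))
                                        (λ i _ i≢k → sym (upd-other x k _ i≢k)) ⟨
    dist D u x                     ≡⟨ dist-preserved u ext ⟨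
    dist D (g u) x                 <⟨ n<1+n _ ⟩
    suc (dist D (g u) x)           ≡⟨ dist-suc-at D (g u) x (g (flipAt k)) (successor k) Dσ guσ≡xσ gfσ≢xσ
                                        (λ i Di i≢σ → successor-unique Dk i Di i≢σ) ⟨
    dist D (g u) (g (flipAt k))    ≤⟨ nonExpansive-dist g-ne D u (flipAt k)
                                        (λ i Di → trans (ext i Di) (sym (flipAt-extends Dk i Di))) ⟩
    dist D u (flipAt k)            ∎)
    where
    open ≤-Reasoning
    Dσ = proj₁ (successor-differs Dk)
    gfσ≢xσ = proj₂ (successor-differs Dk)

  module OnCycle {k} (v : Fin (suc k) → Fin n) (v-injective : Injective _≡_ _≡_ v)
    (v-succ : ∀ t → successor (v t) ≡ v (next t)) (v-in-D : ∀ t → D (v t) ≡ true) where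

    C : Subset n
    C = image v

    C⊆D : ∀ {i} → C i ≡ true → D i ≡ true
    C⊆D Ci with image⇒preimage v Ci
    ... | t , refl = v-in-D t

    ShiftLaw : Conf n → Set
    ShiftLaw u = (∀ t → g u (v (next t)) ≡ u (v t) xor (x (v t) xor x (v (next t)))) ×
                 (∀ i → D i ≡ true → C i ≡ false → g u i ≡ x i)

    -- Induction on the number of cycle vertices where u differs from x: resetting one of them, c, changes g u
    -- only at the successor of c (by non-expansiveness), where it must disagree with x.
    shiftLaw : ∀ u → Extends C x u → ShiftLaw u
    shiftLaw u ext = go _ u ext refl
      where
      go : ∀ N u → Extends C x u → dist C x u ≡ N → ShiftLaw u
      go zero u ext d≡0 =
        (λ t → trans (gu≗x (v-in-D (next t))) (sym (trans (cong (_xor _) (u≗x (v t))) (xor-cancelˡ (x (v t)) _)))) ,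
        λ i Di _ → gu≗x Di
        where
        u≗x : u ≗ x
        u≗x i with C i in Ci
        ... | true  = sym (dist≡0⇒agree C x u d≡0 i Ci)
        ... | false = ext i Ci
        gu≗x : ∀ {i} → D i ≡ true → g u i ≡ x i
        gu≗x {i} Di = trans (nonExpansive-cong g-ne u x u≗x i) (x-fixed i Di)
      go (suc N) u ext d≡suc with difference C x u d≡suc
      ... | c , Cc , xc≢uc with image⇒preimage v Cc
      ... | t₀ , refl = first , second
        where
        u′ = upd u (v t₀) (x (v t₀))
        u′≗u : ∀ {i} → i ≢ v t₀ → u′ i ≡ u i
        u′≗u = upd-other u (v t₀) (x (v t₀))
        uc≢u′c : u (v t₀) ≢ u′ (v t₀)
        uc≢u′c eq = xc≢uc (sym (trans eq (upd-same u (v t₀) _)))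
        law′ : ShiftLaw u′
        law′ = go N u′ (Extends-upd (v t₀) _ Cc ext) (suc-injective (trans
          (sym (dist-suc-at C x u′ u (v t₀) Cc (sym (upd-same u (v t₀) _)) uc≢u′c λ i _ i≢c → sym (u′≗u i≢c)))
          d≡suc))
        gu-differs : g u (v (next t₀)) ≢ x (v (next t₀))
        gu-differs = subst (λ i → g u i ≢ x i) (v-succ t₀)
          (successor-disagrees u (λ i Di → ext i (D≡false⇒C≡false Di)) (v-in-D t₀) (xc≢uc ∘ sym))
          where
          D≡false⇒C≡false : ∀ {i} → D i ≡ false → C i ≡ false
          D≡false⇒C≡false {i} Di with C i in Ci
          ... | true  = contradiction (trans (sym Di) (C⊆D Ci)) false≢true
          ... | false = refl
        gu′-agrees : g u′ (v (next t₀)) ≡ x (v (next t₀))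
        gu′-agrees = trans (proj₁ law′ t₀) (trans (cong (_xor _) (upd-same u (v t₀) _)) (xor-cancelˡ (x (v t₀)) _))
        g-close : dist D (g u′) (g u) ≤ 1
        g-close = ≤-trans
          (nonExpansive-dist g-ne D u′ u λ i Di → u′≗u λ i≡c → false≢true (trans (sym Di) (trans (cong D i≡c) (v-in-D t₀))))
          (≤-reflexive (trans (dist-suc-at D u′ u′ u (v t₀) (v-in-D t₀) refl uc≢u′c λ i _ i≢c → sym (u′≗u i≢c))
                              (cong suc (agree⇒dist≡0 D u′ u′ λ _ _ → refl))))
        g-agree : ∀ i → D i ≡ true → i ≢ v (next t₀) → g u′ i ≡ g u i
        g-agree = dist≤1⇒unique-difference D (g u′) (g u) g-close (v-in-D (next t₀))
          λ eq → gu-differs (trans (sym eq) gu′-agrees)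
        first : ∀ t → g u (v (next t)) ≡ u (v t) xor (x (v t) xor x (v (next t)))
        first t with t ≟ t₀
        ... | yes refl = ≢-xor gu-differs (xc≢uc ∘ sym)
        ... | no  t≢t₀ = begin
          g u (v (next t))                             ≡⟨ g-agree _ (v-in-D (next t)) (t≢t₀ ∘ next-injective ∘ v-injective) ⟨
          g u′ (v (next t))                            ≡⟨ proj₁ law′ t ⟩
          u′ (v t) xor (x (v t) xor x (v (next t)))    ≡⟨ cong (_xor _) (u′≗u (t≢t₀ ∘ v-injective)) ⟩
          u (v t) xor (x (v t) xor x (v (next t)))     ∎
          where open ≡-Reasoning
        second : ∀ i → D i ≡ true → C i ≡ false → g u i ≡ x i
        second i Di Ci = trans (sym (g-agree i Di λ i≡vn → false≢true (trans (sym Ci) (trans (cong C i≡vn) (image-∋ v (next t₀))))))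
                               (proj₂ law′ i Di Ci)

    flipped : Conf n
    flipped i = x i xor C i

    flipped-extends : Extends C x flipped
    flipped-extends i Ci = trans (cong (x i xor_) Ci) (xor-identityʳ (x i))

    flipped-fixed : FixedOn g D flipped
    flipped-fixed i Di with C i in Ci
    ... | false = trans (proj₂ (shiftLaw flipped flipped-extends) i Di Ci) (sym (xor-identityʳ (x i)))
    ... | true with image⇒preimage v Ci
    ... | t′ , refl with next-surjective t′
    ... | t , refl = trans (proj₁ (shiftLaw flipped flipped-extends) t)
                           (trans (cong (λ c → (x (v t) xor c) xor _) (image-∋ v t)) (flip-across (x (v t)) _))
      where
      flip-across : ∀ a b → (a xor true) xor (a xor b) ≡ b xor true
      flip-across false false = refl
      flip-across false true  = refl
      flip-across true  false = refl
      flip-across true  true  = refl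

    y≗flipped⊕D∖C : ∀ i → y i ≡ flipped i xor (D ∖ C) i
    y≗flipped⊕D∖C i with C i in Ci
    ... | false = trans (y≗x⊕D i) (cong₂ _xor_ (sym (xor-identityʳ (x i))) (sym (∧-identityʳ (D i))))
    ... | true  = trans (y≗x⊕D i) (trans (cong (x i xor_) (C⊆D Ci))
                    (sym (trans (cong ((x i xor true) xor_) (∧-zeroʳ (D i))) (xor-identityʳ _))))

CycleThrough : ∀ {n} → Network n → Fin n → Set
CycleThrough {n} g j = ∃ λ k → Σ (Fin (suc k) → Fin n) λ v → Σ (Conf n) λ b →
  Injective _≡_ _≡_ v × v zero ≡ j × CyclicShift g (image v) b v (λ t → b (v t) xor b (v (next t)))

-- If the cycle found from j misses j, flipping x on it gives a new fixed point, and we recurse on D minus the cycle.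
fixedPair⇒cycle : ∀ {n} {g : Network n} → NonExpansive g → ∀ N (D : Subset n) x y → count D ≤ N →
  (∀ i → y i ≡ x i xor D i) → FixedOn g D x → FixedOn g D y → ∀ {j} → D j ≡ true → CycleThrough g j
fixedPair⇒cycle g-ne zero D x y |D|≤0 _ _ _ Dj = contradiction (≤-trans (count>0 D Dj) |D|≤0) λ ()
fixedPair⇒cycle {g = g} g-ne (suc N) D x y |D|≤1+N y≗x⊕D x-fixed y-fixed {j} Dj =
  fromCycle (orbit-cycle successor (λ i → D i ≡ true) (λ Di → proj₁ (successor-differs Di)) Dj)
  where
  open FixedPair g-ne D x y y≗x⊕D x-fixed y-fixed
  fromCycle : CycleReached successor (λ i → D i ≡ true) j → CycleThrough g j
  fromCycle (k , v , v-injective , v-succ , v-in-D , inj₁ v₀≡j) =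
    k , v , x , v-injective , v₀≡j , λ u ext → proj₁ (OnCycle.shiftLaw v v-injective v-succ v-in-D u ext)
  fromCycle (k , v , v-injective , v-succ , v-in-D , inj₂ j∉v) =
    fixedPair⇒cycle g-ne N (D ∖ C) flipped y (s≤s⁻¹ (≤-trans (count-∖< D C (v-in-D zero) (image-∋ v zero)) |D|≤1+N))
      y≗flipped⊕D∖C (λ i D∖Ci → flipped-fixed i (∖⊆ D C D∖Ci)) (λ i D∖Ci → y-fixed i (∖⊆ D C D∖Ci))
      (cong₂ (λ d c → d ∧ not c) Dj (image-∌ v j∉v))
    where open OnCycle v v-injective v-succ v-in-D

disagreement : ∀ {n} → Subset n → Conf n → Conf n → Subset n
disagreement I x y c = I c ∧ (x c xor y c)

disagreement⊆ : ∀ {n} (I : Subset n) {x y c} → disagreement I x y c ≡ true → I c ≡ true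
disagreement⊆ I {c = c} Dc with I c
... | true = refl

disagreement-xor : ∀ {n} {I : Subset n} {z x y} → Extends I z x → Extends I z y →
                   ∀ c → y c ≡ x c xor disagreement I x y c
disagreement-xor {I = I} {x = x} {y} ext-x ext-y c with I c in Ic
... | false = trans (ext-y c Ic) (sym (trans (xor-identityʳ (x c)) (ext-x c Ic)))
... | true  = sym (xor-cancelˡ (x c) (y c))

CircularThrough : ∀ {n} → Network n → Conf n → Fin n → Set
CircularThrough {n} f e j = ∃ λ k → Σ (Fin (suc k) → Fin n) λ v → Σ (Conf n) λ b →
  Injective _≡_ _≡_ v × v zero ≡ j × Circular (𝟙 (parity (e ∘ v))) f (image v) b

fixedPair⇒circular : ∀ {n} {f : Network n} → NonExpansive f → ∀ e (D : Subset n) x y →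
  (∀ i → y i ≡ x i xor D i) → FixedOn (f ⊕ e) D x → FixedOn (f ⊕ e) D y → ∀ {j} → D j ≡ true →
  CircularThrough f e j
fixedPair⇒circular {f = f} f-ne e D x y y≗x⊕D x-fixed y-fixed Dj
  with k , v , b , v-injective , v₀≡j , shift
         ← fixedPair⇒cycle (nonExpansive-⊕ f-ne e) (count D) D x y ≤-refl y≗x⊕D x-fixed y-fixed Dj
  = k , v , b , v-injective , v₀≡j , subst (λ p → Circular (𝟙 p) f (image v) b) parity-signs (shift⇒circular {f = f} v-injective shift-f)
  where
  signs : Fin (suc k) → Bool
  signs t = (b (v t) xor b (v (next t))) xor e (v (next t))
  shift-f : CyclicShift f (image v) b v signs
  shift-f u ext t = begin
    f u (v (next t))                                                  ≡⟨ xor-cancelʳ (f u (v (next t))) (e (v (next t))) ⟨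
    (f u (v (next t)) xor e (v (next t))) xor e (v (next t))          ≡⟨ cong (_xor e (v (next t))) (shift u ext t) ⟩
    (u (v t) xor (b (v t) xor b (v (next t)))) xor e (v (next t))     ≡⟨ xor-assoc (u (v t)) _ _ ⟩
    u (v t) xor signs t                                               ∎
    where open ≡-Reasoning
  parity-signs : parity signs ≡ parity (e ∘ v)
  parity-signs = begin
    parity signs                                                      ≡⟨ parity-xor (λ t → b (v t) xor b (v (next t))) (e ∘ v ∘ next) ⟩
    parity (λ t → b (v t) xor b (v (next t))) xor parity (e ∘ v ∘ next) ≡⟨ cong₂ _xor_ (parity-differences (b ∘ v)) (sum-∘next xor-commutativeMonoid (e ∘ v)) ⟩
    parity (e ∘ v)                                                    ∎
    where open ≡-Reasoning

module _ {n} {f : Network n} (f-ne : NonExpansive f) where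

  private
    f-cong : Congruent f
    f-cong = nonExpansive-cong f-ne

  positiveCircular⇒¬atMostOne : ∀ {I z} → PositiveCircular f I z → ¬ AtMostOneFixed f I z
  positiveCircular⇒¬atMostOne (_ , _ , _ , v-injective , cover , onCycle , arcs , s , signs , even) =
    evenShift⇒twoFixed (circular-shift f-cong cover onCycle arcs signs) onCycle v-injective cover
      (𝟙-injective (trans (sym (countTrue%2 s)) even))

  negativeCircular⇒¬fixed : ∀ {I z} → NegativeCircular f I z → ∀ u → ¬ SubFixed f I z u
  negativeCircular⇒¬fixed (_ , _ , _ , _ , cover , onCycle , arcs , s , signs , odd) =
    oddShift⇒noFixed (circular-shift f-cong cover onCycle arcs signs) onCycle
      (𝟙-injective (trans (sym (countTrue%2 s)) odd))

  ¬positiveCircular⇒atMostOne : ¬ (∃ λ I → ∃ λ z → NonEmpty I × PositiveCircular f I z) →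
                                 ∀ I z → AtMostOneFixed f I z
  ¬positiveCircular⇒atMostOne noCircuit I z x y (ext-x , x-fixed) (ext-y , y-fixed) i Ii =
    decidable-stable (x i ≟ᵇ y i) λ xi≢yi →
      let k , v , b , _ , _ , circular = fixedPair⇒circular f-ne zeros (disagreement I x y) x y
                                           (disagreement-xor ext-x ext-y) (fixed x-fixed) (fixed y-fixed)
                                           (cong₂ _∧_ Ii (xor-differ xi≢yi))
      in noCircuit (image v , b , (v zero , image-∋ v zero) ,
                    subst (λ p → Circular (𝟙 p) f (image v) b) (parity-allFalse (zeros ∘ v) λ _ → refl) circular)
    where
    zeros : Conf n
    zeros _ = false
    fixed : ∀ {w} → (∀ c → I c ≡ true → f w c ≡ w c) → FixedOn (f ⊕ zeros) (disagreement I x y) w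
    fixed {w} w-fixed c Dc = trans (xor-identityʳ (f w c)) (w-fixed c (disagreement⊆ I {x} {y} Dc))

  module WithoutVertex {I : Subset n} {j} (Ij : I j ≡ true) where

    isJ : Conf n
    isJ c = does (c ≟ j)

    I′ : Subset n
    I′ = I ∖ isJ

    I′j : I′ j ≡ false
    I′j = trans (cong (λ d → I j ∧ not d) (dec-true (j ≟ j) refl)) (∧-zeroʳ (I j))

    I′-intro : ∀ {c} → I c ≡ true → c ≢ j → I′ c ≡ true
    I′-intro {c} Ic c≢j = cong₂ (λ a d → a ∧ not d) Ic (dec-false (c ≟ j) c≢j)

    extends : ∀ {z α w} → Extends I′ (upd z j α) w → Extends I z w
    extends {z} {α} ext c Ic =
      trans (ext c (cong (_∧ _) Ic)) (upd-other z j α λ c≡j → false≢true (trans (sym Ic) (trans (cong I c≡j) Ij)))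

    fixedAt-j : ∀ {w} → (∀ c → I′ c ≡ true → f w c ≡ w c) → f w j ≡ w j → ∀ c → I c ≡ true → f w c ≡ w c
    fixedAt-j w-fixed fixed-j c Ic with c ≟ j
    ... | yes refl = fixed-j
    ... | no  c≢j  = w-fixed c (I′-intro Ic c≢j)

    movedAt-j⇒fixed : ∀ {w} → (∀ c → I′ c ≡ true → f w c ≡ w c) → f w j ≢ w j → FixedOn (f ⊕ isJ) I w
    movedAt-j⇒fixed {w} w-fixed moved c Ic with c ≟ j
    ... | yes refl = trans (xor-comm (f w c) true) (sym (¬-not (moved ∘ sym)))
    ... | no  c≢j  = trans (xor-identityʳ (f w c)) (w-fixed c (I′-intro Ic c≢j))

    -- Solutions with j frozen to false and to true that are both moved at j are fixed points of f ⊕ isJ.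
    movedAt-j⇒negativeCircular : ∀ {z w₀ w₁} → SubFixed f I′ (upd z j false) w₀ → SubFixed f I′ (upd z j true) w₁ →
      f w₀ j ≢ w₀ j → f w₁ j ≢ w₁ j → ∃ λ I → ∃ λ z → NonEmpty I × NegativeCircular f I z
    movedAt-j⇒negativeCircular {z} {w₀} {w₁} (ext₀ , fixed₀) (ext₁ , fixed₁) moved₀ moved₁ =
      negative (fixedPair⇒circular f-ne isJ (disagreement I w₀ w₁) w₀ w₁
        (disagreement-xor (extends ext₀) (extends ext₁))
        (λ c Dc → movedAt-j⇒fixed fixed₀ moved₀ c (disagreement⊆ I {w₀} {w₁} Dc))
        (λ c Dc → movedAt-j⇒fixed fixed₁ moved₁ c (disagreement⊆ I {w₀} {w₁} Dc))
        (cong₂ _∧_ Ij (cong₂ _xor_ (trans (ext₀ j I′j) (upd-same z j false)) (trans (ext₁ j I′j) (upd-same z j true)))))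
      where
      negative : CircularThrough f isJ j → ∃ λ I → ∃ λ z → NonEmpty I × NegativeCircular f I z
      negative (k , v , b , v-injective , v₀≡j , circular) =
        image v , b , (v zero , image-∋ v zero) , subst (λ p → Circular (𝟙 p) f (image v) b) parity-isJ circular
        where
        parity-isJ : parity (isJ ∘ v) ≡ true
        parity-isJ = parity-unique (isJ ∘ v) zero (dec-true (v zero ≟ j) v₀≡j)
          λ t t≢0 → dec-false (v t ≟ j) λ vt≡j → t≢0 (v-injective (trans vt≡j (sym v₀≡j)))

  ¬negativeCircular⇒atLeastOne : ¬ (∃ λ I → ∃ λ z → NonEmpty I × NegativeCircular f I z) →
                                  ∀ I z → AtLeastOneFixed f I z
  ¬negativeCircular⇒atLeastOne noCircuit I z = go _ I z ≤-refl
    where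
    go : ∀ N I z → count I ≤ N → AtLeastOneFixed f I z
    go N I z |I|≤N with any? (λ c → I c ≟ᵇ true)
    go N       I z |I|≤N   | no  empty    = z , (λ _ _ → refl) , λ i Ii → contradiction (i , Ii) empty
    go zero    I z |I|≤0   | yes (j , Ij) = contradiction (≤-trans (count>0 I Ij) |I|≤0) λ ()
    go (suc N) I z |I|≤1+N | yes (j , Ij) = extend (go N I′ (upd z j false) |I′|≤N) (go N I′ (upd z j true) |I′|≤N)
      where
      open WithoutVertex {I} {j} Ij
      |I′|≤N : count I′ ≤ N
      |I′|≤N = s≤s⁻¹ (≤-trans (count-∖< I isJ Ij (dec-true (j ≟ j) refl)) |I|≤1+N)
      extend : AtLeastOneFixed f I′ (upd z j false) → AtLeastOneFixed f I′ (upd z j true) → AtLeastOneFixed f I z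
      extend (w₀ , sol₀) (w₁ , sol₁) with f w₀ j ≟ᵇ w₀ j | f w₁ j ≟ᵇ w₁ j
      ... | yes fixed₀ | _         = w₀ , extends (proj₁ sol₀) , fixedAt-j (proj₂ sol₀) fixed₀
      ... | no  _      | yes fixed₁ = w₁ , extends (proj₁ sol₁) , fixedAt-j (proj₂ sol₁) fixed₁
      ... | no  moved₀ | no  moved₁ = contradiction (movedAt-j⇒negativeCircular sol₀ sol₁ moved₀ moved₁) noCircuit

corollary7 : ∀ (n : ℕ) (f : Network (suc n)) → NonExpansive f →
    ((∀ I z → NonEmpty I → AtMostOneFixed f I z)
       ⇔ (¬ (∃ λ I → ∃ λ z → NonEmpty I × PositiveCircular f I z)))
    ×
    ((∀ I z → NonEmpty I → AtLeastOneFixed f I z)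
       ⇔ (¬ (∃ λ I → ∃ λ z → NonEmpty I × NegativeCircular f I z)))
corollary7 n f f-ne =
  mk⇔ (λ atMostOne (I , z , nonEmpty , circular) →
         positiveCircular⇒¬atMostOne f-ne circular (atMostOne I z nonEmpty))
      (λ noCircuit I z _ → ¬positiveCircular⇒atMostOne f-ne noCircuit I z) ,
  mk⇔ (λ atLeastOne (I , z , nonEmpty , circular) →
         uncurry (negativeCircular⇒¬fixed f-ne circular) (atLeastOne I z nonEmpty))
      (λ noCircuit I z _ → ¬negativeCircular⇒atLeastOne f-ne noCircuit I z)
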